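{- Let $n \geq 32$. Consider the Zeckendorf game on $n$ with $7$ players divided into two alliances, one with $5$ players and one with $2$ players (in any positions). Then the $5$-player alliance always has a winning strategy.
   Context: Let $F_1=1$, $F_2=2$, $F_{i+1}=F_i+F_{i-1}$. The Zeckendorf game on $n$ starts with the multiset of $n$ copies of $1$. A move is one of: if the list contains $F_{i-1}$ and $F_i$, replace them by $F_{i+1}$; if the list contains two copies of $F_i$: for $i=1$ replace them by $F_2$; for $i=2$ replace them by $F_1,F_3$; for $i\geq 3$ replace them by $F_{i-2},F_{i+1}$. The game ends when the list is the Zeckendorf decomposition of $n$ (distinct, pairwise non-consecutive Fibonacci numbers); every game terminates. With $p$ players, players $1,\dots,p$ move in cyclic order $1,2,\dots,p,1,2,\dots$ starting with player 1. An alliance wins if the final move is made by one of its members; it has a winning strategy if its members can choose their moves so that the final move is made by a member no matter what moves the other players make. -}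

module Defs where

open import Data.Nat using (ℕ; zero; suc; _+_; _≤_)
open import Data.Nat.DivMod using (_mod_)
open import Data.Fin using (Fin)
open import Data.Fin.Subset using (Subset; _∈_; _∉_)
open import Data.List using (List; []; _∷_; map)
open import Data.Nat.ListAction using (sum)
open import Data.List.Relation.Unary.Unique.Propositional using (Unique)
open import Data.List.Relation.Binary.Permutation.Propositional using (_↭_)
import Data.List.Membership.Propositional as LM
open import Data.Product using (Σ; ∃; ∃₂; _×_; _,_)
open import Data.Sum using (_⊎_)
open import Relation.Nullary using (¬_)
open import Relation.Binary.PropositionalEquality using (_≡_)

-- Fibonacci numbers with the paper's indexing: fib 1 = 1, fib 2 = 2,
-- fib (i+1) = fib i + fib (i-1).  (fib 0 = 1 is a dummy value, never used.)
fib : ℕ → ℕ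
fib zero = 1
fib (suc zero) = 1
fib (suc (suc zero)) = 2
fib (suc (suc (suc i))) = fib (suc (suc i)) + fib (suc i)

-- A game position is a multiset of Fibonacci numbers, represented as a list
-- of Fibonacci INDICES (an entry i stands for the number F_i = fib i);
-- lists are taken up to permutation via _↭_ in the move relation.

data Step : List ℕ → List ℕ → Set where
  -- F_{i-1}, F_i  ↦  F_{i+1}   (i ≥ 2), written with j = i-1 ≥ 1
  combine   : ∀ j r → 1 ≤ j → Step (j ∷ suc j ∷ r) (suc (suc j) ∷ r)
  double1   : ∀ r → Step (1 ∷ 1 ∷ r) (2 ∷ r)
  double2   : ∀ r → Step (2 ∷ 2 ∷ r) (1 ∷ 3 ∷ r)
  -- F_i, F_i  ↦  F_{i-2}, F_{i+1}   (i ≥ 3), written with i = k+3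
  doubleBig : ∀ k r → Step (suc (suc (suc k)) ∷ suc (suc (suc k)) ∷ r)
                            (suc k ∷ suc (suc (suc (suc k))) ∷ r)

Move : List ℕ → List ℕ → Set
Move s s' = ∃₂ λ a b → (s ↭ a) × Step a b × (b ↭ s')

IsZeckendorfOf : ℕ → List ℕ → Set
IsZeckendorfOf n s =
  Unique s × (∀ i → i LM.∈ s → ¬ (suc i LM.∈ s)) × (sum (map fib s) ≡ n)

-- Game with p players (indexed 0..p-1 = players 1..p); at global turn t
-- (starting at 0) player (t mod p) moves.  WinsFrom p A n t s : the alliance
-- A has a winning strategy from the (not yet finished) position s when it
-- is turn t, i.e. it can force that the final move is made by a member.
data WinsFrom (p : ℕ) .{{_ : Data.Nat.NonZero p}} (A : Subset p) (n : ℕ)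
       : ℕ → List ℕ → Set where
  ally  : ∀ {t s} → ¬ IsZeckendorfOf n s → (t mod p) ∈ A →
          (Σ (List ℕ) λ s' → Move s s' × (IsZeckendorfOf n s' ⊎ WinsFrom p A n (suc t) s')) →
          WinsFrom p A n t s
  enemy : ∀ {t s} → ¬ IsZeckendorfOf n s → (t mod p) ∉ A →
          (∀ s' → Move s s' → WinsFrom p A n (suc t) s') →
          WinsFrom p A n t s

start : ℕ → List ℕ
start n = Data.List.replicate n 1

-- Strategy stealing.  The game is finite, hence determined, and an alliance C that holds the seat
-- d turns after every seat of an alliance B can replay any winning strategy of B with a delay of
-- d turns.  The five players spend an opening merging pairs of 1s into 2s (an opponent's move
-- destroys at most two 1s and two 2s) until, at a turn T where they own 2d consecutive seats, the
-- position contains four 1s and d 2s; here d is 1 or 2 and every opponent seat is followed by an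
-- allied one d turns later (d = 1 works unless the two opponents sit side by side, d = 2 then).
-- From there the five can reach one and the same position X in d moves or in 2d moves.  If the
-- opponents win from X when it is reached quickly, the five reach it slowly instead and replay
-- the opponents' strategy.  A suitable T with 2T + 4 ≤ 32 exists for each of the 21 seatings.

module Submission where

open import Defs
open import Function using (_∘_)
open import Data.Nat using (ℕ; zero; suc; _+_; _*_; _∸_; _≤_; _<_; z≤n; s≤s; _≟_; _≤?_; NonZero)
open import Data.Nat.Properties
open import Data.Nat.DivMod using (_mod_; _%_; %-distribˡ-+; m%n%n≡m%n)
open import Data.Nat.Induction using (<-wellFounded)
open import Data.Nat.ListAction using (sum)
open import Data.Nat.ListAction.Properties using (sum-↭)
open import Data.Nat.Tactic.RingSolver using (solve-∀)
open import Induction.WellFounded using (Acc; acc)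
open import Data.Fin using (Fin; toℕ)
open import Data.Fin.Properties using (toℕ-fromℕ<; fromℕ<-cong; all?; any?)
open import Data.Fin.Subset using (Subset; ∁; ∣_∣) renaming (_∈_ to _∈ₛ_; _∉_ to _∉ₛ_)
open import Data.Fin.Subset.Properties
  using (x∈p⇒x∉∁p; x∉p⇒x∈∁p; anySubset?) renaming (_∈?_ to _∈ₛ?_)
open import Data.List using (List; []; _∷_; _++_; map; concatMap; [_]; filter; length; replicate)
open import Data.List.Properties using (filter-accept; filter-reject)
open import Data.List.Relation.Unary.All as All using (All; []; _∷_)
open import Data.List.Relation.Unary.Any using (Any; here; there) renaming (any? to anyᴸ?)
open import Data.List.Relation.Unary.AllPairs using ([]; _∷_)
open import Data.List.Relation.Unary.Unique.Propositional using (Unique)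
open import Data.List.Relation.Unary.Unique.DecPropositional _≟_ using (unique?)
open import Data.List.Membership.Propositional using (_∈_; _∉_; find; lose)
open import Data.List.Membership.Propositional.Properties
  using (∈-map⁺; ∈-map⁻; ∈-concatMap⁺; ∈-concatMap⁻)
open import Data.List.Membership.DecPropositional _≟_ using (_∈?_)
open import Data.List.Relation.Binary.Permutation.Propositional
  using (_↭_; refl; prep; swap; ↭-sym; ↭-trans; ↭⇒↭ₛ)
open import Data.List.Relation.Binary.Permutation.Propositional.Properties
  using (map⁺; ∈-resp-↭; All-resp-↭; drop-∷; shift; ++⁺ˡ; filter-↭; ↭-length)
import Data.List.Relation.Binary.Permutation.Setoid.Properties as PermutationSetoid
open import Data.Product using (∃; ∃₂; _×_; _,_; proj₁; map₂; uncurry)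
open import Data.Sum as Sum using (_⊎_; inj₁; inj₂)
open import Data.Empty using (⊥-elim)
open import Data.Unit using (⊤; tt)
open import Relation.Nullary using (¬_; Dec; yes; no; ¬?)
open import Relation.Nullary.Decidable
  using (True; toWitness; _×-dec_; _⊎-dec_; _→-dec_; map′; from-no; decidable-stable)
open import Relation.Binary.PropositionalEquality
  using (_≡_; _≢_; refl; sym; trans; cong; subst; subst₂; setoid; module ≡-Reasoning)

fibSum : List ℕ → ℕ
fibSum s = sum (map fib s)

fibSum-↭ : ∀ {xs ys} → xs ↭ ys → fibSum xs ≡ fibSum ys
fibSum-↭ p = sum-↭ (map⁺ fib p)

Unique-↭ : ∀ {xs ys : List ℕ} → xs ↭ ys → Unique xs → Unique ys
Unique-↭ p = PermutationSetoid.Unique-resp-↭ (setoid ℕ) (↭⇒↭ₛ p)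

IsZeckendorfOf-↭ : ∀ {n xs ys} → xs ↭ ys → IsZeckendorfOf n xs → IsZeckendorfOf n ys
IsZeckendorfOf-↭ p (unique , nonConsecutive , sum≡n) =
  Unique-↭ p unique ,
  (λ i i∈ys 1+i∈ys →
    nonConsecutive i (∈-resp-↭ (↭-sym p) i∈ys) (∈-resp-↭ (↭-sym p) 1+i∈ys)) ,
  trans (sym (fibSum-↭ p)) sum≡n

Move-↭ˡ : ∀ {s s′ c} → s ↭ s′ → Move s′ c → Move s c
Move-↭ˡ q (a , b , s′↭a , st , b↭c) = a , b , ↭-trans q s′↭a , st , b↭c

IsPositionOf : ℕ → List ℕ → Set
IsPositionOf n s = All (1 ≤_) s × fibSum s ≡ n

IsPositionOf-↭ : ∀ {n xs ys} → xs ↭ ys → IsPositionOf n xs → IsPositionOf n ys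
IsPositionOf-↭ p (positive , sum≡n) = All-resp-↭ p positive , trans (sym (fibSum-↭ p)) sum≡n

step-positive : ∀ {a b} → Step a b → All (1 ≤_) a → All (1 ≤_) b
step-positive (combine j r _) (_ ∷ _ ∷ rest) = s≤s z≤n ∷ rest
step-positive (double1 r)     (_ ∷ _ ∷ rest) = s≤s z≤n ∷ rest
step-positive (double2 r)     (_ ∷ _ ∷ rest) = s≤s z≤n ∷ s≤s z≤n ∷ rest
step-positive (doubleBig k r) (_ ∷ _ ∷ rest) = s≤s z≤n ∷ s≤s z≤n ∷ rest

step-fibSum : ∀ {a b} → Step a b → fibSum a ≡ fibSum b
step-fibSum (combine (suc i) r _) = combine-sum (fib (suc i)) (fib (suc (suc i))) (fibSum r)
  where
  combine-sum : ∀ a b R → a + (b + R) ≡ (b + a) + R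
  combine-sum = solve-∀
step-fibSum (double1 r) = refl
step-fibSum (double2 r) = refl
step-fibSum (doubleBig k r) = double-sum (fib (suc k)) (fib (suc (suc k))) (fibSum r)
  where
  double-sum : ∀ a b R → (b + a) + ((b + a) + R) ≡ a + (((b + a) + b) + R)
  double-sum = solve-∀

move-position : ∀ {n s c} → Move s c → IsPositionOf n s → IsPositionOf n c
move-position (a , b , s↭a , st , b↭c) pos =
  let positive , sum≡n = IsPositionOf-↭ s↭a pos
  in IsPositionOf-↭ b↭c (step-positive st positive , trans (sym (step-fibSum st)) sum≡n)

-- Concave enough that every step lowers the total weight; 3 i + 3 would not be,
-- as F_2 + F_2 ↦ F_1 + F_3 shows.
partWeight : ℕ → ℕ
partWeight zero = 0
partWeight (suc zero) = 5
partWeight (suc (suc k)) = 9 + 3 * k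

weight : List ℕ → ℕ
weight s = sum (map partWeight s)

weight-↭ : ∀ {xs ys} → xs ↭ ys → weight xs ≡ weight ys
weight-↭ p = sum-↭ (map⁺ partWeight p)

private
  <-by-slack : ∀ {c e} d → c + suc d ≡ e → c < e
  <-by-slack {c} d refl = m<m+n c (s≤s z≤n)

  <-+-tail₁ : ∀ {c x y} R → c < x + y → c + R < x + (y + R)
  <-+-tail₁ {c} {x} {y} R h = subst (c + R <_) (+-assoc x y R) (+-monoˡ-< R h)

  <-+-tail₂ : ∀ {c d x y} R → c + d < x + y → c + (d + R) < x + (y + R)
  <-+-tail₂ {c} {d} {x} {y} R h = subst₂ _<_ (+-assoc c d R) (+-assoc x y R) (+-monoˡ-< R h)

  combine-slack : ∀ k → 9 + 3 * suc (suc k) + suc (5 + 3 * k) ≡ 9 + 3 * k + (9 + 3 * suc k)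
  combine-slack = solve-∀

  double-slack : ∀ m →
    9 + 3 * m + (9 + 3 * suc (suc (suc m))) + 3 ≡ 9 + 3 * suc (suc m) + (9 + 3 * suc (suc m))
  double-slack = solve-∀

step-weight : ∀ {a b} → Step a b → weight b < weight a
step-weight (combine (suc zero) r _) =
  <-+-tail₁ {12} {5} {9} (weight r) (<-by-slack 1 refl)
step-weight (combine (suc (suc k)) r _) =
  <-+-tail₁ {partWeight (4 + k)} {partWeight (2 + k)} {partWeight (3 + k)} (weight r)
    (<-by-slack (5 + 3 * k) (combine-slack k))
step-weight (double1 r) = <-+-tail₁ {9} {5} {5} (weight r) (<-by-slack 0 refl)
step-weight (double2 r) = <-+-tail₂ {5} {12} {9} {9} (weight r) (<-by-slack 0 refl)
step-weight (doubleBig zero r) = <-+-tail₂ {5} {15} {12} {12} (weight r) (<-by-slack 3 refl)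
step-weight (doubleBig (suc m) r) =
  <-+-tail₂ {partWeight (2 + m)} {partWeight (5 + m)} {partWeight (4 + m)} {partWeight (4 + m)}
    (weight r)
    (<-by-slack 2 (double-slack m))

move-weight : ∀ {s c} → Move s c → weight c < weight s
move-weight (a , b , s↭a , st , b↭c) =
  subst₂ _<_ (weight-↭ b↭c) (sym (weight-↭ s↭a)) (step-weight st)

picks : List ℕ → List (ℕ × List ℕ)
picks [] = []
picks (x ∷ xs) = (x , xs) ∷ map (map₂ (x ∷_)) (picks xs)

picks-sound : ∀ {s y r} → (y , r) ∈ picks s → s ↭ y ∷ r
picks-sound {x ∷ xs} (here refl) = refl
picks-sound {x ∷ xs} (there m) with ∈-map⁻ (map₂ (x ∷_)) m
... | (y , r) , m′ , refl = ↭-trans (prep x (picks-sound m′)) (swap x y refl)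

picks-∈ : ∀ {s y} → y ∈ s → ∃ λ r → (y , r) ∈ picks s
picks-∈ (here refl) = _ , here refl
picks-∈ {x ∷ xs} (there y∈xs) =
  let r , m = picks-∈ y∈xs in x ∷ r , there (∈-map⁺ (map₂ (x ∷_)) m)

picks-complete : ∀ {s y r′} → s ↭ y ∷ r′ → ∃ λ r → (y , r) ∈ picks s × r ↭ r′
picks-complete s↭ =
  let r , m = picks-∈ (∈-resp-↭ (↭-sym s↭) (here refl))
  in r , m , drop-∷ (↭-trans (↭-sym (picks-sound m)) s↭)

∈⇒↭ : ∀ {y s} → y ∈ s → ∃ λ r → s ↭ y ∷ r
∈⇒↭ y∈s = let r , m = picks-∈ y∈s in r , picks-sound m

doublings : ℕ → List ℕ → List (List ℕ)
doublings zero r = []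
doublings (suc zero) r = [ 2 ∷ r ]
doublings (suc (suc zero)) r = [ 1 ∷ 3 ∷ r ]
doublings (suc (suc (suc k))) r = [ suc k ∷ suc (suc (suc (suc k))) ∷ r ]

steps : ℕ → ℕ → List ℕ → List (List ℕ)
steps zero y r = []
steps x@(suc _) y r with y ≟ x | y ≟ suc x
... | yes refl | _      = doublings x r
... | no _     | yes refl = [ suc (suc x) ∷ r ]
... | no _     | no _   = []

doublings-sound : ∀ {x r b} → b ∈ doublings x r → Step (x ∷ x ∷ r) b
doublings-sound {suc zero} (here refl) = double1 _
doublings-sound {suc (suc zero)} (here refl) = double2 _
doublings-sound {suc (suc (suc k))} (here refl) = doubleBig k _

steps-sound : ∀ {x y r b} → b ∈ steps x y r → Step (x ∷ y ∷ r) b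
steps-sound {suc i} {y} m with y ≟ suc i | y ≟ suc (suc i)
steps-sound m           | yes refl | _ = doublings-sound m
steps-sound (here refl) | no _ | yes refl = combine _ _ (s≤s z≤n)

steps-complete : ∀ {x y r b} → Step (x ∷ y ∷ r) b → b ∈ steps x y r
steps-complete (combine (suc i) r _) with suc (suc i) ≟ suc i | suc (suc i) ≟ suc (suc i)
... | yes 2+i≡1+i | _ = ⊥-elim (1+n≢n 2+i≡1+i)
... | no _ | yes refl = here refl
... | no _ | no 2+i≢2+i = ⊥-elim (2+i≢2+i refl)
steps-complete (double1 r) = here refl
steps-complete (double2 r) = here refl
steps-complete (doubleBig k r) rewrite ≟-diag {suc (suc (suc k))} refl = here refl

step-resp-tail : ∀ {x y r r′ b} → r ↭ r′ → Step (x ∷ y ∷ r′) b →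
  ∃ λ b′ → Step (x ∷ y ∷ r) b′ × b′ ↭ b
step-resp-tail r↭r′ (combine j _ 1≤j) = _ , combine j _ 1≤j , prep _ r↭r′
step-resp-tail r↭r′ (double1 _)       = _ , double1 _ , prep _ r↭r′
step-resp-tail r↭r′ (double2 _)       = _ , double2 _ , prep _ (prep _ r↭r′)
step-resp-tail r↭r′ (doubleBig k _)   = _ , doubleBig k _ , prep _ (prep _ r↭r′)

stepsFrom : ℕ × List ℕ → List (List ℕ)
stepsFrom (x , r) = concatMap (uncurry (steps x)) (picks r)

successors : List ℕ → List (List ℕ)
successors s = concatMap stepsFrom (picks s)

successors-sound : ∀ {s c} → c ∈ successors s → Move s c
successors-sound {s} c∈ =
  let (x , r₁) , xr₁∈ , c∈₁ = find (∈-concatMap⁻ stepsFrom {xs = picks s} c∈)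
      (y , r₂) , yr₂∈ , c∈₂ = find (∈-concatMap⁻ (uncurry (steps x)) {xs = picks r₁} c∈₁)
  in x ∷ y ∷ r₂ , _ , ↭-trans (picks-sound xr₁∈) (prep x (picks-sound yr₂∈)) ,
     steps-sound c∈₂ , refl

successor-of-pair-step : ∀ {s x y r b} → s ↭ x ∷ y ∷ r → Step (x ∷ y ∷ r) b →
  ∃ λ c → c ∈ successors s × c ↭ b
successor-of-pair-step {x = x} s↭ st =
  let r₁ , xr₁∈ , r₁↭ = picks-complete s↭
      r₂ , yr₂∈ , r₂↭ = picks-complete r₁↭
      c , st′ , c↭b = step-resp-tail r₂↭ st
      c∈ = ∈-concatMap⁺ (uncurry (steps x)) (lose yr₂∈ (steps-complete st′))
  in c , ∈-concatMap⁺ stepsFrom (lose xr₁∈ c∈) , c↭b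

successor-of-step : ∀ {s a b} → s ↭ a → Step a b → ∃ λ c → c ∈ successors s × c ↭ b
successor-of-step s↭ st@(combine _ _ _) = successor-of-pair-step s↭ st
successor-of-step s↭ st@(double1 _)     = successor-of-pair-step s↭ st
successor-of-step s↭ st@(double2 _)     = successor-of-pair-step s↭ st
successor-of-step s↭ st@(doubleBig _ _) = successor-of-pair-step s↭ st

successors-complete : ∀ {s c} → Move s c → ∃ λ c′ → c′ ∈ successors s × c′ ↭ c
successors-complete (_ , _ , s↭a , st , b↭c) =
  let c′ , c′∈ , c′↭b = successor-of-step s↭a st in c′ , c′∈ , ↭-trans c′↭b b↭c

NonConsecutive : List ℕ → Set
NonConsecutive s = ∀ i → i ∈ s → suc i ∉ s

isZeckendorfOf? : ∀ n s → Dec (IsZeckendorfOf n s)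
isZeckendorfOf? n s = unique? s ×-dec nonConsecutive? ×-dec (fibSum s ≟ n)
  where
  nonConsecutive? : Dec (NonConsecutive s)
  nonConsecutive? = map′ (λ all i → All.lookup all) (λ nc → All.tabulate (nc _))
    (All.all? (λ i → ¬? (suc i ∈? s)) s)

step-insert : ∀ x {a b} → Step a b →
  ∃₂ λ a′ b′ → x ∷ a ↭ a′ × Step a′ b′ × b′ ↭ x ∷ b
step-insert x (combine j r 1≤j) =
  _ , _ , ↭-sym (shift x (j ∷ suc j ∷ []) r) , combine j (x ∷ r) 1≤j , shift x [ _ ] r
step-insert x (double1 r) = _ , _ , ↭-sym (shift x (1 ∷ 1 ∷ []) r) , double1 (x ∷ r) , shift x [ 2 ] r
step-insert x (double2 r) =
  _ , _ , ↭-sym (shift x (2 ∷ 2 ∷ []) r) , double2 (x ∷ r) , shift x (1 ∷ 3 ∷ []) r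
step-insert x (doubleBig k r) =
  _ , _ , ↭-sym (shift x (_ ∷ _ ∷ []) r) , doubleBig k (x ∷ r) , shift x (_ ∷ _ ∷ []) r

Move-∷ : ∀ x {s c} → Move s c → Move (x ∷ s) (x ∷ c)
Move-∷ x (a , b , s↭a , st , b↭c) =
  let a′ , b′ , xa↭a′ , st′ , b′↭xb = step-insert x st
  in a′ , b′ , ↭-trans (prep x s↭a) xa↭a′ , st′ , ↭-trans b′↭xb (prep x b↭c)

double-step : ∀ x r → 1 ≤ x → ∃ λ b → Step (x ∷ x ∷ r) b
double-step (suc zero) r _ = _ , double1 r
double-step (suc (suc zero)) r _ = _ , double2 r
double-step (suc (suc (suc k))) r _ = _ , doubleBig k r

move-or-Zeckendorf-shape : ∀ s → All (1 ≤_) s →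
  (∃ λ c → Move s c) ⊎ (Unique s × NonConsecutive s)
move-or-Zeckendorf-shape [] [] = inj₂ ([] , λ _ ())
move-or-Zeckendorf-shape (x ∷ xs) (1≤x ∷ positive)
  with x ∈? xs | suc x ∈? xs | anyᴸ? (λ y → suc y ≟ x) xs | move-or-Zeckendorf-shape xs positive
... | yes x∈xs | _ | _ | _ =
  let r , xs↭ = ∈⇒↭ x∈xs ; b , st = double-step x r 1≤x
  in inj₁ (b , _ , b , prep x xs↭ , st , refl)
... | no _ | yes 1+x∈xs | _ | _ =
  let r , xs↭ = ∈⇒↭ 1+x∈xs
  in inj₁ (_ , _ , _ , prep x xs↭ , combine x r 1≤x , refl)
... | no _ | no _ | yes pred-x∈xs | _ = inj₁ (combine-with-predecessor (find pred-x∈xs))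
  where
  combine-with-predecessor : (∃ λ y → y ∈ xs × suc y ≡ x) → ∃ λ c → Move (x ∷ xs) c
  combine-with-predecessor (y , y∈xs , refl) =
    let r , xs↭ = ∈⇒↭ y∈xs
    in _ , _ , _ , ↭-trans (prep (suc y) xs↭) (swap (suc y) y refl) ,
       combine y r (All.lookup positive y∈xs) , refl
... | no _ | no _ | no _ | inj₁ (c , mv) = inj₁ (x ∷ c , Move-∷ x mv)
... | no x∉xs | no 1+x∉xs | no pred-x∉xs | inj₂ (unique , nonConsecutive) =
  inj₂ (All.tabulate (λ { y∈xs refl → x∉xs y∈xs }) ∷ unique , nonConsecutive′)
  where
  nonConsecutive′ : NonConsecutive (x ∷ xs)
  nonConsecutive′ _ (here refl) (here 1+x≡x) = 1+n≢n 1+x≡x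
  nonConsecutive′ _ (here refl) (there 1+x∈xs) = 1+x∉xs 1+x∈xs
  nonConsecutive′ _ (there i∈xs) (here refl) = pred-x∉xs (lose i∈xs refl)
  nonConsecutive′ i (there i∈xs) (there 1+i∈xs) = nonConsecutive i i∈xs 1+i∈xs

move-exists : ∀ {n s} → IsPositionOf n s → ¬ IsZeckendorfOf n s → ∃ λ c → Move s c
move-exists {s = s} (positive , sum≡n) nz with move-or-Zeckendorf-shape s positive
... | inj₁ move = move
... | inj₂ (unique , nonConsecutive) = ⊥-elim (nz (unique , nonConsecutive , sum≡n))

count : ℕ → List ℕ → ℕ
count k s = length (filter (_≟ k) s)

count-↭ : ∀ k {xs ys} → xs ↭ ys → count k xs ≡ count k ys
count-↭ k p = ↭-length (filter-↭ (_≟ k) p)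

count-∷-self : ∀ k xs → count k (k ∷ xs) ≡ suc (count k xs)
count-∷-self k xs = cong length (filter-accept (_≟ k) {xs = xs} refl)

count-∷-≤ : ∀ k x xs → count k (x ∷ xs) ≤ suc (count k xs)
count-∷-≤ k x xs with x ≟ k
... | yes x≡k rewrite filter-accept (_≟ k) {xs = xs} x≡k = ≤-refl
... | no x≢k rewrite filter-reject (_≟ k) {xs = xs} x≢k = n≤1+n _

count-≤-∷ : ∀ k x xs → count k xs ≤ count k (x ∷ xs)
count-≤-∷ k x xs with x ≟ k
... | yes x≡k rewrite filter-accept (_≟ k) {xs = xs} x≡k = n≤1+n _
... | no x≢k rewrite filter-reject (_≟ k) {xs = xs} x≢k = ≤-refl

count-step : ∀ k {a b} → Step a b → count k a ≤ 2 + count k b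
count-step k {x ∷ y ∷ r} {b} st = begin
  count k (x ∷ y ∷ r)  ≤⟨ ≤-trans (count-∷-≤ k x (y ∷ r)) (s≤s (count-∷-≤ k y r)) ⟩
  2 + count k r        ≤⟨ +-monoʳ-≤ 2 (tail≤ st) ⟩
  2 + count k b        ∎
  where
  open ≤-Reasoning
  tail≤ : ∀ {x y r b} → Step (x ∷ y ∷ r) b → count k r ≤ count k b
  tail≤ (combine j r _)  = count-≤-∷ k (2 + j) r
  tail≤ (double1 r)      = count-≤-∷ k 2 r
  tail≤ (double2 r)      = ≤-trans (count-≤-∷ k 3 r) (count-≤-∷ k 1 (3 ∷ r))
  tail≤ (doubleBig j r)  = ≤-trans (count-≤-∷ k (4 + j) r) (count-≤-∷ k (1 + j) (4 + j ∷ r))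

count-move : ∀ k {s c} → Move s c → count k s ≤ 2 + count k c
count-move k (a , b , s↭a , st , b↭c) =
  subst₂ (λ u v → u ≤ 2 + v) (sym (count-↭ k s↭a)) (count-↭ k b↭c) (count-step k st)

count-replicate-≢ : ∀ {j k} → k ≢ j → ∀ a r → count j (replicate a k ++ r) ≡ count j r
count-replicate-≢ _ zero r = refl
count-replicate-≢ {j} {k} k≢j (suc a) r =
  trans (cong length (filter-reject (_≟ j) {xs = replicate a k ++ r} k≢j)) (count-replicate-≢ k≢j a r)

count-pos⇒∈ : ∀ {k s} → 1 ≤ count k s → k ∈ s
count-pos⇒∈ {k} {x ∷ xs} h with x ≟ k
... | yes refl = here refl
... | no x≢k rewrite filter-reject (_≟ k) {xs = xs} x≢k = there (count-pos⇒∈ h)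

extract-copies : ∀ k a s → a ≤ count k s → ∃ λ r → s ↭ replicate a k ++ r
extract-copies k zero s _ = s , refl
extract-copies k (suc a) s h =
  let s′ , s↭ = ∈⇒↭ (count-pos⇒∈ (≤-trans (s≤s z≤n) h))
      a≤count = ≤-pred (≤-trans h (≤-reflexive (trans (count-↭ k s↭) (count-∷-self k s′))))
      r , s′↭ = extract-copies k a s′ a≤count
  in r , ↭-trans s↭ (prep k s′↭)

start-position : ∀ n → IsPositionOf n (start n)
start-position zero = [] , refl
start-position (suc n) =
  let positive , sum≡n = start-position n in s≤s z≤n ∷ positive , cong suc sum≡n

count-start-ones : ∀ n → count 1 (start n) ≡ n
count-start-ones zero = refl
count-start-ones (suc n) = cong suc (count-start-ones n)

count-start-twos : ∀ n → count 2 (start n) ≡ 0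
count-start-twos zero = refl
count-start-twos (suc n) = count-start-twos n

any-or-all : ∀ {A : Set} {P Q : A → Set} xs → (∀ {x} → x ∈ xs → P x ⊎ Q x) →
  Any P xs ⊎ All Q xs
any-or-all [] _ = inj₂ []
any-or-all (x ∷ xs) classify with classify (here refl) | any-or-all xs (classify ∘ there)
... | inj₁ px | _        = inj₁ (here px)
... | inj₂ _  | inj₁ any = inj₁ (there any)
... | inj₂ qx | inj₂ all = inj₂ (qx ∷ all)

two-copies-not-Unique : ∀ {k s} → 2 ≤ count k s → ¬ Unique s
two-copies-not-Unique {k} {s} twice unique with extract-copies k 2 s twice
... | r , s↭ with Unique-↭ s↭ unique
... | (k≢k ∷ _) ∷ _ = k≢k refl

two-ones-not-Zeckendorf : ∀ {n s} → 2 ≤ count 1 s → ¬ IsZeckendorfOf n s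
two-ones-not-Zeckendorf twice = two-copies-not-Unique twice ∘ proj₁

unfinished : ∀ {n s} {twoOnes : True (2 ≤? count 1 s)} → ¬ IsZeckendorfOf n s
unfinished {twoOnes = twoOnes} = two-ones-not-Zeckendorf (toWitness twoOnes)

extract-twos-and-ones : ∀ a b {s} → a ≤ count 1 s → b ≤ count 2 s →
  ∃ λ r → s ↭ replicate b 2 ++ replicate a 1 ++ r
extract-twos-and-ones a b {s} ones twos =
  let r₂ , s↭ = extract-copies 2 b s twos
      ones′ = subst (a ≤_) (trans (count-↭ 1 s↭) (count-replicate-≢ (λ ()) b r₂)) ones
      r , r₂↭ = extract-copies 1 a r₂ ones′
  in r , ↭-trans s↭ (++⁺ˡ (replicate b 2) r₂↭)

module _ {p : ℕ} .⦃ _ : NonZero p ⦄ where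

  WinsFrom-↭ : ∀ {A n t s s′} → s ↭ s′ → WinsFrom p A n t s → WinsFrom p A n t s′
  WinsFrom-↭ s↭s′ (ally nz t∈A (c , mv , win)) =
    ally (nz ∘ IsZeckendorfOf-↭ (↭-sym s↭s′)) t∈A (c , Move-↭ˡ (↭-sym s↭s′) mv , win)
  WinsFrom-↭ s↭s′ (enemy nz t∉A wins) =
    enemy (nz ∘ IsZeckendorfOf-↭ (↭-sym s↭s′)) t∉A (λ c → wins c ∘ Move-↭ˡ s↭s′)

  mover-decides : ∀ (M N : Subset p) {n t s} →
    ¬ IsZeckendorfOf n s → t mod p ∈ₛ M → t mod p ∉ₛ N →
    (∀ {c} → Move s c → ¬ IsZeckendorfOf n c →
      WinsFrom p M n (suc t) c ⊎ WinsFrom p N n (suc t) c) →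
    WinsFrom p M n t s ⊎ WinsFrom p N n t s
  mover-decides M N {n} {t} {s} nz t∈M t∉N next with any-or-all (successors s) classify
    where
    classify : ∀ {c} → c ∈ successors s →
      (IsZeckendorfOf n c ⊎ WinsFrom p M n (suc t) c) ⊎ WinsFrom p N n (suc t) c
    classify {c} c∈ with isZeckendorfOf? n c
    ... | yes z = inj₁ (inj₁ z)
    ... | no nz′ with next (successors-sound c∈) nz′
    ...   | inj₁ w = inj₁ (inj₂ w)
    ...   | inj₂ w = inj₂ w
  ... | inj₁ good =
    let c , c∈ , win = find good in inj₁ (ally nz t∈M (c , successors-sound c∈ , win))
  ... | inj₂ bad = inj₂ (enemy nz t∉N λ c mv →
    let c′ , c′∈ , c′↭c = successors-complete mv in WinsFrom-↭ c′↭c (All.lookup bad c′∈))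

  determined : ∀ (B : Subset p) n t s → ¬ IsZeckendorfOf n s →
    WinsFrom p B n t s ⊎ WinsFrom p (∁ B) n t s
  determined B n t s = go t s (<-wellFounded (weight s))
    where
    go : ∀ t s → Acc _<_ (weight s) → ¬ IsZeckendorfOf n s →
      WinsFrom p B n t s ⊎ WinsFrom p (∁ B) n t s
    go t s (acc smaller) nz with t mod p ∈ₛ? B
    ... | yes t∈B = mover-decides B (∁ B) nz t∈B (x∈p⇒x∉∁p t∈B)
      λ mv → go (suc t) _ (smaller (move-weight mv))
    ... | no t∉B = Sum.swap (mover-decides (∁ B) B nz (x∉p⇒x∈∁p t∉B) t∉B
      λ mv nz′ → Sum.swap (go (suc t) _ (smaller (move-weight mv)) nz′))

  CoversWithDelay : Subset p → Subset p → ℕ → Set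
  CoversWithDelay B C d = ∀ i → i ∈ₛ B → (d + toℕ i) mod p ∈ₛ C

  +-toℕ-mod : ∀ d t → (d + toℕ (t mod p)) mod p ≡ (d + t) mod p
  +-toℕ-mod d t = fromℕ<-cong _ _ (begin
    (d + toℕ (t mod p)) % p  ≡⟨ cong (λ x → (d + x) % p) (toℕ-fromℕ< _) ⟩
    (d + t % p) % p          ≡⟨ %-distribˡ-+ d (t % p) p ⟩
    (d % p + t % p % p) % p  ≡⟨ cong (λ x → (d % p + x) % p) (m%n%n≡m%n t p) ⟩
    (d % p + t % p) % p      ≡⟨ sym (%-distribˡ-+ d t p) ⟩
    (d + t) % p              ∎) _ _
    where open ≡-Reasoning

  covered-turn : ∀ {B C d t} → CoversWithDelay B C d → t mod p ∈ₛ B → (d + t) mod p ∈ₛ C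
  covered-turn {C = C} {d} {t} covers t∈B = subst (_∈ₛ C) (+-toℕ-mod d t) (covers (t mod p) t∈B)

  -- At a seat of C that is not d turns after one of B, C plays an arbitrary move, which the
  -- strategy of B survives as an opponent's move.
  wins-delayed : ∀ {B C d n t s} → CoversWithDelay B C d → IsPositionOf n s →
    WinsFrom p B n t s → WinsFrom p C n (d + t) s

  delayed-move : ∀ {B C d n t s} → CoversWithDelay B C d → IsPositionOf n s →
    WinsFrom p B n (suc t) s → WinsFrom p C n (suc (d + t)) s

  wins-delayed covers pos (ally nz t∈B (c , mv , inj₁ z)) =
    ally nz (covered-turn covers t∈B) (c , mv , inj₁ z)
  wins-delayed covers pos (ally nz t∈B (c , mv , inj₂ win)) =
    ally nz (covered-turn covers t∈B) (c , mv , inj₂ (delayed-move covers (move-position mv pos) win))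
  wins-delayed {C = C} {d} covers pos (enemy {t} nz t∉B wins) with (d + t) mod p ∈ₛ? C
  ... | yes mine = let c , mv = move-exists pos nz in
    ally nz mine (c , mv , inj₂ (delayed-move covers (move-position mv pos) (wins c mv)))
  ... | no theirs = enemy nz theirs λ c mv → delayed-move covers (move-position mv pos) (wins c mv)

  delayed-move {C = C} {d} {n} {t} {s} covers pos win =
    subst (λ u → WinsFrom p C n u s) (+-suc d t) (wins-delayed covers pos win)

  data AllyRun (A : Subset p) (n : ℕ) : ℕ → List ℕ → ℕ → List ℕ → Set where
    stay : ∀ {t s} → AllyRun A n t s t s
    play : ∀ {t s c u x} → ¬ IsZeckendorfOf n s → t mod p ∈ₛ A → Move s c →
           AllyRun A n (suc t) c u x → AllyRun A n t s u x

  wins-after-run : ∀ {A n t s u x} → AllyRun A n t s u x → WinsFrom p A n u x → WinsFrom p A n t s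
  wins-after-run stay win = win
  wins-after-run (play nz t∈A mv run) win = ally nz t∈A (_ , mv , inj₂ (wins-after-run run win))

  run-position : ∀ {A n t s u x} → AllyRun A n t s u x → IsPositionOf n s → IsPositionOf n x
  run-position stay pos = pos
  run-position (play _ _ mv run) pos = run-position run (move-position mv pos)

  strategy-stealing : ∀ {A n t s u x d} → CoversWithDelay (∁ A) A d → IsPositionOf n s →
    ¬ IsZeckendorfOf n x → AllyRun A n t s u x → AllyRun A n t s (d + u) x → WinsFrom p A n t s
  strategy-stealing {A} {n} {u = u} {x} covers pos nz fast slow with determined A n u x nz
  ... | inj₁ win = wins-after-run fast win
  ... | inj₂ loss = wins-after-run slow (wins-delayed covers (run-position fast pos) loss)

  AllyTurns : Subset p → ℕ → ℕ → Set
  AllyTurns A t zero = ⊤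
  AllyTurns A t (suc k) = t mod p ∈ₛ A × AllyTurns A (suc t) k

  Steal : Subset p → ℕ → ℕ → Set
  Steal A b t = CoversWithDelay (∁ A) A b × AllyTurns A t (2 * b)

  steal-with-one-two : ∀ {A t n} r → Steal A 1 t → IsPositionOf n (2 ∷ 1 ∷ 1 ∷ 1 ∷ 1 ∷ r) →
    WinsFrom p A n t (2 ∷ 1 ∷ 1 ∷ 1 ∷ 1 ∷ r)
  steal-with-one-two {A} {t} {n} r (covers , t∈A , t+1∈A , _) pos =
    strategy-stealing covers pos unfinished fast slow
    where
    -- in values, fast: 1 + 2 ↦ 3;  slow: 1 + 1 ↦ 2, then 2 + 2 ↦ 1 + 3
    fast : AllyRun A n t (2 ∷ 1 ∷ 1 ∷ 1 ∷ 1 ∷ r) (suc t) (3 ∷ 1 ∷ 1 ∷ 1 ∷ r)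
    fast = play unfinished t∈A
      (_ , _ , swap 2 1 refl , combine 1 (1 ∷ 1 ∷ 1 ∷ r) (s≤s z≤n) , refl) stay
    slow : AllyRun A n t (2 ∷ 1 ∷ 1 ∷ 1 ∷ 1 ∷ r) (1 + suc t) (3 ∷ 1 ∷ 1 ∷ 1 ∷ r)
    slow = play unfinished t∈A
      (_ , _ , ↭-sym (shift 2 (1 ∷ 1 ∷ []) (1 ∷ 1 ∷ r)) , double1 (2 ∷ 1 ∷ 1 ∷ r) , refl)
      (play unfinished t+1∈A
        (_ , _ , refl , double2 (1 ∷ 1 ∷ r) , swap 1 3 refl) stay)

  steal-with-two-twos : ∀ {A t n} r → Steal A 2 t →
    IsPositionOf n (2 ∷ 2 ∷ 1 ∷ 1 ∷ 1 ∷ 1 ∷ r) →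
    WinsFrom p A n t (2 ∷ 2 ∷ 1 ∷ 1 ∷ 1 ∷ 1 ∷ r)
  steal-with-two-twos {A} {t} {n} r (covers , t∈A , t+1∈A , t+2∈A , t+3∈A , _) pos =
    strategy-stealing covers pos unfinished fast slow
    where
    -- in values, fast: 1 + 2 ↦ 3, 2 + 3 ↦ 5;
    -- slow: 2 + 2 ↦ 1 + 3, 1 + 1 ↦ 2, 1 + 2 ↦ 3, 3 + 3 ↦ 1 + 5
    fast : AllyRun A n t (2 ∷ 2 ∷ 1 ∷ 1 ∷ 1 ∷ 1 ∷ r) (2 + t) (4 ∷ 1 ∷ 1 ∷ 1 ∷ r)
    fast = play unfinished t∈A
      (_ , _ , shift 1 (2 ∷ 2 ∷ []) (1 ∷ 1 ∷ 1 ∷ r) ,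
       combine 1 (2 ∷ 1 ∷ 1 ∷ 1 ∷ r) (s≤s z≤n) , refl)
      (play unfinished t+1∈A
        (_ , _ , swap 3 2 refl , combine 2 (1 ∷ 1 ∷ 1 ∷ r) (s≤s z≤n) , refl) stay)
    slow : AllyRun A n t (2 ∷ 2 ∷ 1 ∷ 1 ∷ 1 ∷ 1 ∷ r) (2 + (2 + t)) (4 ∷ 1 ∷ 1 ∷ 1 ∷ r)
    slow = play unfinished t∈A
      (_ , _ , refl , double2 (1 ∷ 1 ∷ 1 ∷ 1 ∷ r) , refl)
      (play unfinished t+1∈A
        (_ , _ , prep 1 (swap 3 1 refl) , double1 (3 ∷ 1 ∷ 1 ∷ 1 ∷ r) , refl)
      (play unfinished t+2∈A
        (_ , _ , shift 1 (2 ∷ 3 ∷ []) (1 ∷ 1 ∷ r) ,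
         combine 1 (3 ∷ 1 ∷ 1 ∷ r) (s≤s z≤n) , refl)
      (play unfinished t+3∈A
        (_ , _ , refl , doubleBig 0 (1 ∷ 1 ∷ r) , swap 1 4 refl) stay)))

  Endgame : Subset p → ℕ → ℕ → Set
  Endgame A b T =
    ∀ {n} s → IsPositionOf n s → 4 ≤ count 1 s → b ≤ count 2 s → WinsFrom p A n T s

  endgame-one-two : ∀ {A T} → Steal A 1 T → Endgame A 1 T
  endgame-one-two steal s pos ones twos =
    let r , s↭ = extract-twos-and-ones 4 1 ones twos
    in WinsFrom-↭ (↭-sym s↭) (steal-with-one-two r steal (IsPositionOf-↭ s↭ pos))

  endgame-two-twos : ∀ {A T} → Steal A 2 T → Endgame A 2 T
  endgame-two-twos steal s pos ones twos =
    let r , s↭ = extract-twos-and-ones 4 2 ones twos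
    in WinsFrom-↭ (↭-sym s↭) (steal-with-two-twos r steal (IsPositionOf-↭ s↭ pos))

  -- The 2s needed before turn t, given the r needed after it: the alliance makes one from two 1s,
  -- an opponent destroys at most two.
  twosBefore : ∀ {A t} → Dec (t mod p ∈ₛ A) → ℕ → ℕ
  twosBefore (yes _) r = r ∸ 1
  twosBefore (no _) zero = zero
  twosBefore (no _) (suc r) = 3 + r

  twosNeeded : Subset p → ℕ → ℕ → ℕ → ℕ
  twosNeeded A b t zero = b
  twosNeeded A b t (suc k) = twosBefore (t mod p ∈ₛ? A) (twosNeeded A b (suc t) k)

  opening : ∀ {A b} k {t n s} → Endgame A b (k + t) → IsPositionOf n s →
    2 * k + 4 ≤ count 1 s → twosNeeded A b t k ≤ count 2 s → WinsFrom p A n t s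
  opening zero end pos ones twos = end _ pos ones twos
  opening {A} {b} (suc k) {t} {n} {s} end pos ones twos = turn (t mod p ∈ₛ? A) twos
    where
    ones′ : 2 + (2 * k + 4) ≤ count 1 s
    ones′ = ≤-trans (≤-reflexive (cong (_+ 4) (sym (*-suc 2 k)))) ones

    ongoing : ¬ IsZeckendorfOf n s
    ongoing = two-ones-not-Zeckendorf (≤-trans (m≤m+n 2 _) ones′)

    continue : ∀ {c} → IsPositionOf n c → 2 * k + 4 ≤ count 1 c →
      twosNeeded A b (suc t) k ≤ count 2 c → WinsFrom p A n (suc t) c
    continue = opening k (subst (Endgame A b) (sym (+-suc k t)) end)

    turn : (mine? : Dec (t mod p ∈ₛ A)) → twosBefore mine? (twosNeeded A b (suc t) k) ≤ count 2 s →
      WinsFrom p A n t s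
    turn (yes t∈A) twos =
      let r , s↭ = extract-copies 1 2 s (≤-trans (m≤m+n 2 _) ones′)
          merge = (_ , _ , s↭ , double1 r , refl)
      in ally ongoing t∈A (2 ∷ r , merge , inj₂ (continue (move-position merge pos)
           (+-cancelˡ-≤ 2 _ _ (≤-trans ones′ (≤-reflexive (count-↭ 1 s↭))))
           (≤-trans (m≤n+m∸n _ 1) (s≤s (≤-trans twos (≤-reflexive (count-↭ 2 s↭)))))))
    turn (no t∉A) twos = enemy ongoing t∉A λ c mv → continue (move-position mv pos)
      (+-cancelˡ-≤ 2 _ _ (≤-trans ones′ (count-move 1 mv)))
      (opponent-twos _ twos (count-move 2 mv))
      where
      opponent-twos : ∀ r {a c} → twosBefore (no t∉A) r ≤ a → a ≤ 2 + c → r ≤ c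
      opponent-twos zero _ _ = z≤n
      opponent-twos (suc r) need a≤2+c = +-cancelˡ-≤ 2 _ _ (≤-trans need a≤2+c)

  wins-from-start : ∀ {A b T n} → Endgame A b T → twosNeeded A b 0 T ≡ 0 → 2 * T + 4 ≤ n →
    WinsFrom p A n 0 (start n)
  wins-from-start {A} {b} {T} {n} end ready bound =
    opening T (subst (Endgame A b) (sym (+-identityʳ T)) end) (start-position n)
      (subst (2 * T + 4 ≤_) (sym (count-start-ones n)) bound)
      (subst₂ _≤_ (sym ready) (sym (count-start-twos n)) z≤n)

  Schedule : Subset p → ℕ → ℕ → Set
  Schedule A b T = Steal A b T × twosNeeded A b 0 T ≡ 0

  schedule-wins : ∀ {A T n} → Schedule A 1 T ⊎ Schedule A 2 T → 2 * T + 4 ≤ n →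
    WinsFrom p A n 0 (start n)
  schedule-wins (inj₁ (steal , ready)) = wins-from-start (endgame-one-two steal) ready
  schedule-wins (inj₂ (steal , ready)) = wins-from-start (endgame-two-twos steal) ready

  coversWithDelay? : ∀ B C d → Dec (CoversWithDelay B C d)
  coversWithDelay? B C d = all? (λ i → i ∈ₛ? B →-dec (d + toℕ i) mod p ∈ₛ? C)

  allyTurns? : ∀ A t k → Dec (AllyTurns A t k)
  allyTurns? A t zero = yes tt
  allyTurns? A t (suc k) = t mod p ∈ₛ? A ×-dec allyTurns? A (suc t) k

  schedule? : ∀ A b T → Dec (Schedule A b T)
  schedule? A b T =
    (coversWithDelay? (∁ A) A b ×-dec allyTurns? A T (2 * b)) ×-dec (twosNeeded A b 0 T ≟ 0)

-- Searching T in Fin 15 loses nothing, since 2 T + 4 ≤ 32 forces T ≤ 14.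
Plan : Subset 7 → Fin 15 → Set
Plan A T = 2 * toℕ T + 4 ≤ 32 × (Schedule A 1 (toℕ T) ⊎ Schedule A 2 (toℕ T))

plan? : ∀ A T → Dec (Plan A T)
plan? A T = (2 * toℕ T + 4 ≤? 32) ×-dec (schedule? A 1 (toℕ T) ⊎-dec schedule? A 2 (toℕ T))

five-member-alliances-have-plans : ∀ (A : Subset 7) → ∣ A ∣ ≡ 5 → ∃ (Plan A)
five-member-alliances-have-plans A five =
  decidable-stable (any? (plan? A)) λ noPlan →
    from-no (anySubset? λ B → ¬? (∣ B ∣ ≟ 5 →-dec any? (plan? B)))
      (A , λ plan → noPlan (plan five))

lemma2p4p1 : ∀ (n : ℕ) → 32 ≤ n → (A : Subset 7) → ∣ A ∣ ≡ 5 →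
    WinsFrom 7 A n 0 (start n)
lemma2p4p1 n 32≤n A five =
  let T , bound , schedule = five-member-alliances-have-plans A five
  in schedule-wins {T = toℕ T} schedule (≤-trans bound 32≤n)
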